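{- Let $f:\{0,1\}^n\to\{0,1\}$ be a Boolean function that is not identically $1$ or $0$. Then for $k\in\{0,1\}$, $\Gamma^k(f)\le\Gamma(f)$.
   Context: A partial assignment is $b\in\{0,1,*\}^n$; $a\succeq b$ means $a_i=b_i$ whenever $b_i\ne *$. $b$ is a $0$-certificate (resp. $1$-certificate) of $f$ if $f(a)=0$ (resp. $1$) for all $a\in\{0,1\}^n$ with $a\succeq b$; a certificate is a $0$- or $1$-certificate; $b$ contains a certificate if $b\succeq c$ for some certificate $c$. For $b_i=*$, $b_{x_i\leftarrow\ell}$ is $b$ with coordinate $i$ set to $\ell\in\{0,1\}$. $g:\{0,1,*\}^n\to\mathbb{Z}_{\ge0}$ is monotone if $g(b_{x_i\leftarrow\ell})\ge g(b)$ whenever $b_i=*$, and submodular if $g(b_{x_i\leftarrow\ell})-g(b)\ge g(b'_{x_i\leftarrow\ell})-g(b')$ whenever $b'\succeq b$, $b_i=b'_i=*$. A goal function for $f$ is a monotone submodular $g$ with an integer $Q\ge0$ (its goal value) such that $g(b)=Q$ for all $b\in\{0,1\}^n$ and $g(b)=Q$ iff $b$ contains a certificate of $f$; $\Gamma(f)$ is the minimum goal value of a goal function for $f$. A $1$-goal function for $f$ is a monotone submodular $g$ with a constant $Q\ge0$ (its $1$-goal value) such that $g(b)=Q$ if $b$ is a $1$-certificate of $f$ and $g(b)<Q$ otherwise; $\Gamma^1(f)$ is the minimum $1$-goal value of a $1$-goal function for $f$. $0$-goal functions and $\Gamma^0(f)$ are defined analogously with $0$-certificates. -}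

module Defs where

open import Data.Nat using (ℕ; _≤_; _<_; _+_)
open import Data.Bool using (Bool; true; false)
open import Data.Maybe using (Maybe; just; nothing)
open import Data.Fin using (Fin)
open import Data.Vec using (Vec; lookup; map; _[_]≔_)
open import Data.Product using (Σ; ∃; _×_)
open import Data.Sum using (_⊎_)
open import Relation.Binary.PropositionalEquality using (_≡_)
open import Relation.Nullary using (¬_)

BoolFun : ℕ → Set
BoolFun n = Vec Bool n → Bool

-- Partial assignments {0,1,*}^n : nothing = *, just false = 0, just true = 1.
Partial : ℕ → Set
Partial n = Vec (Maybe Bool) n

total : ∀ {n} → Vec Bool n → Partial n
total a = map just a

_≽_ : ∀ {n} → Partial n → Partial n → Set
b' ≽ b = ∀ i x → lookup b i ≡ just x → lookup b' i ≡ just x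

set : ∀ {n} → Partial n → Fin n → Bool → Partial n
set b i ℓ = b [ i ]≔ just ℓ

IsCert : ∀ {n} → Bool → BoolFun n → Partial n → Set
IsCert k f b = ∀ a → total a ≽ b → f a ≡ k

IsCertificate : ∀ {n} → BoolFun n → Partial n → Set
IsCertificate f b = IsCert false f b ⊎ IsCert true f b

ContainsCert : ∀ {n} → BoolFun n → Partial n → Set
ContainsCert f b = ∃ λ c → IsCertificate f c × b ≽ c

Monotone : ∀ {n} → (Partial n → ℕ) → Set
Monotone g = ∀ b i ℓ → lookup b i ≡ nothing → g b ≤ g (set b i ℓ)

-- g(b_{i←ℓ}) - g(b) ≥ g(b'_{i←ℓ}) - g(b'), written without subtraction.
Submodular : ∀ {n} → (Partial n → ℕ) → Set
Submodular g = ∀ b b' i ℓ → b' ≽ b → lookup b i ≡ nothing → lookup b' i ≡ nothing →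
  g (set b' i ℓ) + g b ≤ g (set b i ℓ) + g b'

IsGoalFunction : ∀ {n} → BoolFun n → (Partial n → ℕ) → ℕ → Set
IsGoalFunction f g Q =
  Monotone g × Submodular g ×
  (∀ a → g (total a) ≡ Q) ×
  (∀ b → (g b ≡ Q → ContainsCert f b) × (ContainsCert f b → g b ≡ Q))

IsKGoalFunction : ∀ {n} → Bool → BoolFun n → (Partial n → ℕ) → ℕ → Set
IsKGoalFunction k f g Q =
  Monotone g × Submodular g ×
  (∀ b → (IsCert k f b → g b ≡ Q) × (¬ IsCert k f b → g b < Q))

NonConstant : ∀ {n} → BoolFun n → Set
NonConstant f = (∃ λ a → f a ≡ true) × (∃ λ a → f a ≡ false)

-- Let U be the set of (not k)-certificates. Certificates of the two kinds form disjoint up-sets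
-- whose union is {g = Q}, so lowering g by one exactly on U gives a function that equals Q
-- precisely on the k-certificates and stays below Q elsewhere. Monotonicity and submodularity
-- survive: the only configurations where the lowering could break them are those where U is
-- entered from a point outside {g = Q}, and there g has a unit of slack. Finally Q > 0, since
-- for non-constant f the all-* assignment contains no certificate.
module Submission where

open import Defs
open import Data.Nat using (ℕ; _≤_; _<_; pred; z≤n; >-nonZero)
open import Data.Nat.Properties
  using (≤-refl; ≤-reflexive; ≤-trans; ≤-<-trans; ≤∧≢⇒<; <⇒≤pred; pred-mono-≤; pred[n]≤n;
         +-comm; +-monoˡ-≤; +-monoʳ-≤; suc-pred)
open import Data.Bool using (Bool; true; false; not)
open import Data.Bool.Properties using (not-¬) renaming (_≟_ to _≟ᵇ_)
open import Data.Maybe using (Maybe; just; nothing; fromMaybe)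
open import Data.Maybe.Properties using (just-injective) renaming (≡-dec to ≡-decᴹ)
open import Data.Fin using (Fin; zero; suc) renaming (_≟_ to _≟ᶠ_)
open import Data.Vec using ([]; _∷_; lookup; replicate)
open import Data.Vec.Properties using (lookup∘update; lookup∘update′; lookup-replicate)
open import Data.Vec.Relation.Binary.Pointwise.Extensional using (ext; Pointwise-≡⇒≡)
open import Data.List using (List; []; _∷_; allFin)
open import Data.List.Membership.Propositional using (_∈_)
open import Data.List.Membership.Propositional.Properties using (∈-allFin)
open import Data.List.Relation.Unary.Any using (here; there)
open import Data.Product using (∃; ∃₂; _×_; _,_; proj₁; proj₂)
open import Data.Sum using (_⊎_; inj₁; inj₂; [_,_])
open import Function using (_∘_)
open import Function.Bundles using (_⇔_; mk⇔)
open import Function.Properties.Equivalence using () renaming (sym to ⇔-sym)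
open import Relation.Nullary using (¬_; Dec; yes; no; contradiction)
open import Relation.Nullary.Decidable using (_×-dec_) renaming (map to Dec-map)
open import Relation.Unary using (Decidable)
open import Relation.Binary.PropositionalEquality hiding ([_])

_≟ᴹ_ : (m m' : Maybe Bool) → Dec (m ≡ m')
_≟ᴹ_ = ≡-decᴹ _≟ᵇ_

≽-refl : ∀ {n} {b : Partial n} → b ≽ b
≽-refl _ _ e = e

≽-trans : ∀ {n} {a b c : Partial n} → a ≽ b → b ≽ c → a ≽ c
≽-trans a≽b b≽c i x e = a≽b i x (b≽c i x e)

≽-replicate-nothing : ∀ {n} (b : Partial n) → b ≽ replicate n nothing
≽-replicate-nothing b i x e = contradiction (trans (sym (lookup-replicate i nothing)) e) λ ()

_∷-≽_ : ∀ {n} {m m' : Maybe Bool} {b b' : Partial n} →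
        (∀ x → m ≡ just x → m' ≡ just x) → b' ≽ b → (m' ∷ b') ≽ (m ∷ b)
(m'≽m ∷-≽ b'≽b) zero = m'≽m
(m'≽m ∷-≽ b'≽b) (suc i) = b'≽b i

≽-tail : ∀ {n} {m m' : Maybe Bool} {b b' : Partial n} → (m' ∷ b') ≽ (m ∷ b) → b' ≽ b
≽-tail h i = h (suc i)

lookup-set-≢ : ∀ {n} (b : Partial n) {i j} ℓ → i ≢ j → lookup (set b i ℓ) j ≡ lookup b j
lookup-set-≢ b ℓ i≢j = lookup∘update′ (i≢j ∘ sym) b (just ℓ)

set-≽ : ∀ {n} (b : Partial n) i ℓ → lookup b i ≡ nothing → set b i ℓ ≽ b
set-≽ b i ℓ bi≡* j x e with i ≟ᶠ j
... | yes refl = contradiction (trans (sym bi≡*) e) λ ()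
... | no i≢j = trans (lookup-set-≢ b ℓ i≢j) e

set-mono : ∀ {n} (b b' : Partial n) i ℓ → b' ≽ b → set b' i ℓ ≽ set b i ℓ
set-mono b b' i ℓ b'≽b j x e with i ≟ᶠ j
... | yes refl = trans (lookup∘update i b' (just ℓ)) (trans (sym (lookup∘update i b (just ℓ))) e)
... | no i≢j = trans (lookup-set-≢ b' ℓ i≢j) (b'≽b j x (trans (sym (lookup-set-≢ b ℓ i≢j)) e))

set-≼ : ∀ {n} {b b' : Partial n} {i x} → b' ≽ b → lookup b' i ≡ just x → b' ≽ set b i x
set-≼ {b = b} {i = i} {x} b'≽b b'i j y e with i ≟ᶠ j
... | yes refl = trans b'i (trans (sym (lookup∘update i b (just x))) e)
... | no i≢j = b'≽b j y (trans (sym (lookup-set-≢ b x i≢j)) e)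

completion : ∀ {n} (b : Partial n) → ∃ λ a → total a ≽ b
completion [] = [] , λ ()
completion (m ∷ b) with completion b
... | a , a≽b = fromMaybe false m ∷ a , fill m ∷-≽ a≽b
  where
  fill : ∀ m x → m ≡ just x → just (fromMaybe false m) ≡ just x
  fill (just _) _ e = e
  fill nothing _ ()

drop-covered : ∀ {A : Set} {P : A → Set} {x : A} {xs : List A} →
               (∀ y → P y → y ∈ x ∷ xs) → ¬ P x → ∀ y → P y → y ∈ xs
drop-covered cover ¬Px y Py with cover y Py
... | here refl = contradiction Py ¬Px
... | there y∈xs = y∈xs

module _ {n} {g : Partial n → ℕ} (g-mono : Monotone g) where

  private
    mono-≽-covered : (L : List (Fin n)) {b b' : Partial n} → b' ≽ b →
                     (∀ i → lookup b i ≢ lookup b' i → i ∈ L) → g b ≤ g b'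
    mono-≽-covered [] {b} {b'} _ cover = ≤-reflexive (cong g (Pointwise-≡⇒≡ (ext agree)))
      where
      agree : ∀ i → lookup b i ≡ lookup b' i
      agree i with lookup b i ≟ᴹ lookup b' i
      ... | yes eq = eq
      ... | no neq with cover i neq
      ...   | ()
    mono-≽-covered (i ∷ L) {b} {b'} b'≽b cover with lookup b i ≟ᴹ lookup b' i
    ... | yes agree = mono-≽-covered L b'≽b (drop-covered cover (λ d → d agree))
    ... | no disagree with lookup b i in bi
    ...   | just x = contradiction (sym (b'≽b i x bi)) disagree
    ...   | nothing with lookup b' i in b'i
    ...     | nothing = contradiction refl disagree
    ...     | just x =
      ≤-trans (g-mono b i x bi) (mono-≽-covered L (set-≼ {b = b} {b'} b'≽b b'i) cover')
      where
      cover″ : ∀ j → lookup (set b i x) j ≢ lookup b' j → j ∈ i ∷ L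
      cover″ j d with i ≟ᶠ j
      ... | yes refl = here refl
      ... | no i≢j = cover j (d ∘ trans (lookup-set-≢ b x i≢j))
      cover' : ∀ j → lookup (set b i x) j ≢ lookup b' j → j ∈ L
      cover' = drop-covered cover″ (λ d → d (trans (lookup∘update i b (just x)) (sym b'i)))

  Monotone⇒mono-≽ : ∀ b b' → b' ≽ b → g b ≤ g b'
  Monotone⇒mono-≽ b b' b'≽b = mono-≽-covered (allFin n) b'≽b (λ i _ → ∈-allFin i)

module _ {n} {f : BoolFun n} where

  IsCert-≽ : ∀ {k} (b b' : Partial n) → b' ≽ b → IsCert k f b → IsCert k f b'
  IsCert-≽ b b' b'≽b cert a a≽b' = cert a (≽-trans {a = total a} {b'} {b} a≽b' b'≽b)

  IsCert⇒¬IsCert-not : ∀ {k} (b : Partial n) → IsCert k f b → ¬ IsCert (not k) f b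
  IsCert⇒¬IsCert-not b cert cert' with completion b
  ... | a , a≽b = not-¬ refl (trans (sym (cert a a≽b)) (cert' a a≽b))

  IsCert⇒ContainsCert : ∀ k (b : Partial n) → IsCert k f b → ContainsCert f b
  IsCert⇒ContainsCert false b cert = b , inj₁ cert , ≽-refl {b = b}
  IsCert⇒ContainsCert true b cert = b , inj₂ cert , ≽-refl {b = b}

  ContainsCert⇒IsCert⊎IsCert-not : ∀ k (b : Partial n) → ContainsCert f b →
                                   IsCert k f b ⊎ IsCert (not k) f b
  ContainsCert⇒IsCert⊎IsCert-not false b (c , inj₁ cert , b≽c) = inj₁ (IsCert-≽ c b b≽c cert)
  ContainsCert⇒IsCert⊎IsCert-not false b (c , inj₂ cert , b≽c) = inj₂ (IsCert-≽ c b b≽c cert)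
  ContainsCert⇒IsCert⊎IsCert-not true b (c , inj₁ cert , b≽c) = inj₂ (IsCert-≽ c b b≽c cert)
  ContainsCert⇒IsCert⊎IsCert-not true b (c , inj₂ cert , b≽c) = inj₁ (IsCert-≽ c b b≽c cert)

  NonConstant⇒¬ContainsCert-replicate : NonConstant f → ¬ ContainsCert f (replicate n nothing)
  NonConstant⇒¬ContainsCert-replicate ((a₁ , fa₁≡true) , (a₀ , fa₀≡false)) contains
    with ContainsCert⇒IsCert⊎IsCert-not true (replicate n nothing) contains
  ... | inj₁ cert = contradiction (trans (sym fa₀≡false) (cert a₀ (≽-replicate-nothing (total a₀)))) λ ()
  ... | inj₂ cert = contradiction (trans (sym fa₁≡true) (cert a₁ (≽-replicate-nothing (total a₁)))) λ ()

IsCert-[] : ∀ {k} {f : BoolFun 0} → IsCert k f [] ⇔ f [] ≡ k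
IsCert-[] = mk⇔ (λ cert → cert [] λ ()) (λ { f[]≡k [] _ → f[]≡k })

IsCert-just : ∀ {n k x} {f : BoolFun (ℕ.suc n)} {b : Partial n} →
              IsCert k f (just x ∷ b) ⇔ IsCert k (f ∘ (x ∷_)) b
IsCert-just {x = x} {f} = mk⇔ (λ cert a a≽b → cert (x ∷ a) ((λ _ e → e) ∷-≽ a≽b)) from
  where
  from : ∀ {k b} → IsCert k (f ∘ (x ∷_)) b → IsCert k f (just x ∷ b)
  from cert (y ∷ a) a≽b with just-injective (a≽b zero x refl)
  ... | refl = cert a (≽-tail a≽b)

IsCert-nothing : ∀ {n k} {f : BoolFun (ℕ.suc n)} {b : Partial n} →
                 IsCert k f (nothing ∷ b) ⇔ (IsCert k (f ∘ (true ∷_)) b × IsCert k (f ∘ (false ∷_)) b)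
IsCert-nothing = mk⇔ (λ cert → (λ a a≽b → cert (true ∷ a) ((λ _ ()) ∷-≽ a≽b))
                             , (λ a a≽b → cert (false ∷ a) ((λ _ ()) ∷-≽ a≽b)))
                     λ { (cert₁ , _) (true ∷ a) a≽b → cert₁ a (≽-tail a≽b)
                       ; (_ , cert₀) (false ∷ a) a≽b → cert₀ a (≽-tail a≽b) }

IsCert? : ∀ {n} k (f : BoolFun n) → Decidable (IsCert k f)
IsCert? k f [] = Dec-map (⇔-sym IsCert-[]) (f [] ≟ᵇ k)
IsCert? k f (just x ∷ b) = Dec-map (⇔-sym IsCert-just) (IsCert? k (f ∘ (x ∷_)) b)
IsCert? k f (nothing ∷ b) =
  Dec-map (⇔-sym IsCert-nothing) (IsCert? k (f ∘ (true ∷_)) b ×-dec IsCert? k (f ∘ (false ∷_)) b)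

module _ {n} {f : BoolFun n} {g : Partial n → ℕ} {Q : ℕ} (goal : IsGoalFunction f g Q) where

  goal-≤ : ∀ b → g b ≤ Q
  goal-≤ b with completion b
  ... | a , a≽b = ≤-trans (Monotone⇒mono-≽ (proj₁ goal) b (total a) a≽b)
                          (≤-reflexive (proj₁ (proj₂ (proj₂ goal)) a))

  goal-< : ∀ b → ¬ ContainsCert f b → g b < Q
  goal-< b ¬cert = ≤∧≢⇒< (goal-≤ b) (¬cert ∘ proj₁ (proj₂ (proj₂ (proj₂ goal)) b))

  NonConstant⇒goal-positive : NonConstant f → 0 < Q
  NonConstant⇒goal-positive nc =
    ≤-<-trans z≤n (goal-< (replicate n nothing) (NonConstant⇒¬ContainsCert-replicate nc))

lowerIf : ∀ {A : Set} → Dec A → ℕ → ℕ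
lowerIf (yes _) v = pred v
lowerIf (no _) v = v

lower : ∀ {n} {U : Partial n → Set} → Decidable U → (Partial n → ℕ) → Partial n → ℕ
lower U? g b = lowerIf (U? b) (g b)

module Lowering {n} {U : Partial n → Set} (U? : Decidable U) {g : Partial n → ℕ} {Q : ℕ}
  (g-mono : Monotone g)
  (U-up : ∀ b b' → b' ≽ b → U b → U b')
  (U⇒Q : ∀ {b} → U b → g b ≡ Q)
  (escape : ∀ {b i ℓ} → lookup b i ≡ nothing → ¬ U b → U (set b i ℓ) → g b < Q)
  where

  U-set : ∀ b i ℓ → lookup b i ≡ nothing → U b → U (set b i ℓ)
  U-set b i ℓ bi≡* = U-up b (set b i ℓ) (set-≽ b i ℓ bi≡*)

  lower-monotone : Monotone (lower U? g)
  lower-monotone b i ℓ bi≡* with U? b | U? (set b i ℓ)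
  ... | yes _ | yes _ = pred-mono-≤ (g-mono b i ℓ bi≡*)
  ... | yes Ub | no ¬Ubi = contradiction (U-set b i ℓ bi≡* Ub) ¬Ubi
  ... | no ¬Ub | yes Ubi rewrite U⇒Q Ubi = <⇒≤pred (escape {b} {i} {ℓ} bi≡* ¬Ub Ubi)
  ... | no _ | no _ = g-mono b i ℓ bi≡*

  lower-submodular : Submodular g → Submodular (lower U? g)
  lower-submodular g-sub b b' i ℓ b'≽b bi≡* b'i≡*
    with U? b | U? (set b i ℓ) | U? b' | U? (set b' i ℓ)
  ... | yes Ub | yes Ubi | yes Ub' | yes Ub'i
    rewrite U⇒Q Ub | U⇒Q Ubi | U⇒Q Ub' | U⇒Q Ub'i = ≤-refl
  ... | yes Ub | no ¬Ubi | _ | _ = contradiction (U-set b i ℓ bi≡* Ub) ¬Ubi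
  ... | yes Ub | yes _ | no ¬Ub' | _ = contradiction (U-up b b' b'≽b Ub) ¬Ub'
  ... | yes _ | yes _ | yes Ub' | no ¬Ub'i = contradiction (U-set b' i ℓ b'i≡* Ub') ¬Ub'i
  ... | no _ | no _ | no _ | no _ = g-sub b b' i ℓ b'≽b bi≡* b'i≡*
  ... | no _ | no _ | no _ | yes _ =
    ≤-trans (+-monoˡ-≤ (g b) (pred[n]≤n {g (set b' i ℓ)})) (g-sub b b' i ℓ b'≽b bi≡* b'i≡*)
  ... | no _ | no _ | yes Ub' | no ¬Ub'i = contradiction (U-set b' i ℓ b'i≡* Ub') ¬Ub'i
  ... | no _ | no _ | yes Ub' | yes Ub'i rewrite U⇒Q Ub' | U⇒Q Ub'i =
    ≤-trans (≤-reflexive (+-comm (pred Q) _)) (+-monoˡ-≤ (pred Q) (g-mono b i ℓ bi≡*))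
  ... | no _ | yes Ubi | _ | no ¬Ub'i =
    contradiction (U-up (set b i ℓ) (set b' i ℓ) (set-mono b b' i ℓ b'≽b) Ubi) ¬Ub'i
  ... | no _ | yes Ubi | no _ | yes Ub'i rewrite U⇒Q Ubi | U⇒Q Ub'i =
    +-monoʳ-≤ (pred Q) (Monotone⇒mono-≽ g-mono b b' b'≽b)
  ... | no ¬Ub | yes Ubi | yes Ub' | yes Ub'i rewrite U⇒Q Ubi | U⇒Q Ub' | U⇒Q Ub'i =
    +-monoʳ-≤ (pred Q) (<⇒≤pred (escape {b} {i} {ℓ} bi≡* ¬Ub Ubi))

module _ {n} {f : BoolFun n} {g : Partial n → ℕ} {Q : ℕ}
         (nc : NonConstant f) (goal : IsGoalFunction f g Q) (k : Bool) where

  private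
    g-cert : ∀ b → ContainsCert f b → g b ≡ Q
    g-cert b = proj₂ (proj₂ (proj₂ (proj₂ goal)) b)

    ¬ContainsCert : ∀ b → ¬ IsCert k f b → ¬ IsCert (not k) f b → ¬ ContainsCert f b
    ¬ContainsCert b ¬cert ¬cert' = [ ¬cert , ¬cert' ] ∘ ContainsCert⇒IsCert⊎IsCert-not k b

    escape : ∀ {b i ℓ} → lookup b i ≡ nothing →
             ¬ IsCert (not k) f b → IsCert (not k) f (set b i ℓ) → g b < Q
    escape {b} {i} {ℓ} bi≡* ¬cert' cert'ᵢ = goal-< goal b (¬ContainsCert b ¬cert ¬cert')
      where
      ¬cert : ¬ IsCert k f b
      ¬cert cert =
        IsCert⇒¬IsCert-not (set b i ℓ) (IsCert-≽ b (set b i ℓ) (set-≽ b i ℓ bi≡*) cert) cert'ᵢ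

  open Lowering (IsCert? (not k) f) (proj₁ goal) IsCert-≽
                (λ {b} → g-cert b ∘ IsCert⇒ContainsCert (not k) b) escape

  goal⇒kGoal : IsKGoalFunction k f (lower (IsCert? (not k) f) g) Q
  goal⇒kGoal = lower-monotone , lower-submodular (proj₁ (proj₂ goal)) , λ b → at-cert b , off-cert b
    where
    at-cert : ∀ b → IsCert k f b → lower (IsCert? (not k) f) g b ≡ Q
    at-cert b cert with IsCert? (not k) f b
    ... | yes cert' = contradiction cert' (IsCert⇒¬IsCert-not b cert)
    ... | no _ = g-cert b (IsCert⇒ContainsCert k b cert)

    off-cert : ∀ b → ¬ IsCert k f b → lower (IsCert? (not k) f) g b < Q
    off-cert b ¬cert with IsCert? (not k) f b
    ... | yes cert' rewrite g-cert b (IsCert⇒ContainsCert (not k) b cert') =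
      ≤-reflexive (suc-pred Q {{>-nonZero (NonConstant⇒goal-positive goal nc)}})
    ... | no ¬cert' = goal-< goal b (¬ContainsCert b ¬cert ¬cert')

theorem6 : (n : ℕ) (f : BoolFun n) → NonConstant f → (k : Bool) →
    (g : Partial n → ℕ) (Q : ℕ) → IsGoalFunction f g Q →
    ∃₂ λ (h : Partial n → ℕ) (Q' : ℕ) → IsKGoalFunction k f h Q' × Q' ≤ Q
theorem6 n f nc k g Q goal = lower (IsCert? (not k) f) g , Q , goal⇒kGoal nc goal k , ≤-refl
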